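{- For every $n\ge 3$, $\lambda(K_n\setminus\{e\},K_2)\ge 1$, where $K_n\setminus\{e\}$ is the complete graph on $n$ vertices with a single edge removed.
   Context: All graphs are finite and simple. For a graph $G$, $d_v$ denotes the degree of $v$, $u\sim v$ means adjacency, and $\mathrm{vol}(G)=\sum_v d_v$. For a metric space $(X,d)$ and $f:V(G)\to X$ set $R_f(G,X)=\frac{\mathrm{vol}(G)\sum_{u\sim v} d(f(u),f(v))^2}{\sum_{u,v} d(f(u),f(v))^2 d_u d_v}$, where the numerator sum is over edges of $G$ and the denominator sum over unordered pairs of vertices; $\lambda(G,X)=\inf_f R_f(G,X)$ over all $f$ with nonzero denominator. $K_2$ is regarded as a two-point metric space with distance $1$. -}

module Defs where

open import Data.Nat using (ℕ; zero; suc; _+_; _*_)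
open import Data.Fin using (Fin; zero; suc; _≟_; _<?_)
open import Data.Bool using (Bool; true; false; if_then_else_; not; _∧_; _∨_)
open import Relation.Nullary.Decidable using (⌊_⌋)
open import Relation.Binary.PropositionalEquality using (_≡_; refl) renaming (sym to ≡-sym)
open import Relation.Nullary using (¬_; yes; no)
open import Data.Empty using (⊥-elim)
open import Data.Bool.Properties using (∨-comm)

sumFin : ∀ {n} → (Fin n → ℕ) → ℕ
sumFin {zero}  g = 0
sumFin {suc n} g = g zero + sumFin (λ i → g (suc i))

-- Σ over unordered pairs {u,v} of distinct vertices (encoded as u < v)
pairSum : ∀ {n} → (Fin n → Fin n → ℕ) → ℕ
pairSum g = sumFin (λ u → sumFin (λ v → if ⌊ u <? v ⌋ then g u v else 0))

record Graph (n : ℕ) : Set where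
  field
    adj   : Fin n → Fin n → Bool
    sym   : ∀ u v → adj u v ≡ adj v u
    irref : ∀ u → adj u u ≡ false
open Graph public

[_] : Bool → ℕ
[ true ]  = 1
[ false ] = 0

degree : ∀ {n} → Graph n → Fin n → ℕ
degree G v = sumFin (λ u → [ adj G v u ])

vol : ∀ {n} → Graph n → ℕ
vol G = sumFin (degree G)

-- K₂ as a two-point metric space {0,1} with distance 1 between distinct points
distK2 : Fin 2 → Fin 2 → ℕ
distK2 x y = if ⌊ x ≟ y ⌋ then 0 else 1

-- numerator of R_f(G,K₂):  vol(G) · Σ_{u∼v} d(f u, f v)²
numR : ∀ {n} → Graph n → (Fin n → Fin 2) → ℕ
numR G f = vol G * pairSum (λ u v → [ adj G u v ] * (distK2 (f u) (f v) * distK2 (f u) (f v)))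

-- denominator of R_f(G,K₂):  Σ_{u,v} d(f u, f v)² d_u d_v  (unordered pairs)
denR : ∀ {n} → Graph n → (Fin n → Fin 2) → ℕ
denR G f = pairSum (λ u v → distK2 (f u) (f v) * distK2 (f u) (f v) * degree G u * degree G v)

-- λ(G,K₂) ≥ 1, unfolded: for every f with nonzero denominator, R_f(G,K₂) = numR/denR ≥ 1,
-- i.e. denR ≤ numR (denominator positive).
λK2≥1 : ∀ {n} → Graph n → Set
λK2≥1 {n} G = (f : Fin n → Fin 2) → ¬ (denR G f ≡ 0) → denR G f Data.Nat.≤ numR G f

≟-sym : ∀ {n} (u v : Fin n) → ⌊ u ≟ v ⌋ ≡ ⌊ v ≟ u ⌋
≟-sym u v with u ≟ v | v ≟ u
... | yes _   | yes _   = refl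
... | yes u≡v | no v≢u  = ⊥-elim (v≢u (≡-sym u≡v))
... | no u≢v  | yes v≡u = ⊥-elim (u≢v (≡-sym v≡u))
... | no _    | no _    = refl

≟-refl : ∀ {n} (u : Fin n) → ⌊ u ≟ u ⌋ ≡ true
≟-refl u with u ≟ u
... | yes _ = refl
... | no u≢u = ⊥-elim (u≢u refl)

isPair : ∀ {n} → Fin n → Fin n → Fin n → Fin n → Bool
isPair a b u v = ⌊ u ≟ a ⌋ ∧ ⌊ v ≟ b ⌋

KnMinusEdge : (n : ℕ) (a b : Fin n) → Graph n
KnMinusEdge n a b = record
  { adj   = A
  ; sym   = symm
  ; irref = irr }
  where
  A : Fin n → Fin n → Bool
  A u v = not ⌊ u ≟ v ⌋ ∧ not (isPair a b u v ∨ isPair a b v u)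
  symm : ∀ u v → A u v ≡ A v u
  symm u v rewrite ≟-sym u v | ∨-comm (isPair a b u v) (isPair a b v u) = refl
  irr : ∀ u → A u u ≡ false
  irr u rewrite ≟-refl u = refl

-- With n = m + 1, every vertex of K_n minus {a,b} has degree m except a and b, which have degree
-- m - 1, so vol = (m + 1) m - 2. For f with sides of sizes S₀, S₁ and volumes D₀, D₁, summing
-- over ordered instead of unordered pairs doubles both sides of R_f ≥ 1, which becomes
-- 2 D₀ D₁ ≤ vol X, X the number of ordered edges across the cut. If a and b lie on the same
-- side then X = 2 S₀ S₁ and D_i ≤ m S_i, and m² ≤ vol because m ≥ 2. Otherwise
-- D_i = m S_i - 1 and X = 2 S₀ S₁ - 2, and S₀ + S₁ = m + 1 gives
-- vol X - 2 D₀ D₁ = 2 (m - 2) S₀ S₁ + 2 ≥ 0.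
module Submission where

open import Defs hiding (sym)
open import Data.Nat using (ℕ; _≤_)
open import Data.Fin using (Fin)
open import Relation.Binary.PropositionalEquality using (_≢_)

open import Data.Bool using (true; false; not; _∧_; _∨_; T; if_then_else_)
open import Data.Bool.Properties using (T-∧)
open import Data.Empty using (⊥; ⊥-elim)
open import Data.Fin using (zero; suc; _≟_; _<?_)
open import Data.Fin.Patterns using (0F; 1F)
open import Data.Nat using (zero; suc; _+_; _*_; s≤s)
open import Data.Nat.Properties hiding (_≟_; _<?_)
open import Data.Nat.Tactic.RingSolver using (solve-∀)
open import Algebra.Properties.CommutativeSemigroup +-commutativeSemigroup using (interchange)
open import Algebra.Properties.CommutativeSemigroup *-commutativeSemigroup using (x∙yz≈y∙xz; xy∙z≈xz∙y)
open import Data.Product using (_×_; _,_)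
open import Function using (_∘_; Equivalence)
open import Relation.Binary.PropositionalEquality
  using (_≡_; _≗_; refl; sym; trans; cong; cong₂; subst₂; module ≡-Reasoning)
open import Relation.Nullary.Decidable using (⌊_⌋; ⌊⌋-map′; toWitness)

sumFin-cong : ∀ {n} {g h : Fin n → ℕ} → g ≗ h → sumFin g ≡ sumFin h
sumFin-cong {zero}  g≗h = refl
sumFin-cong {suc n} g≗h = cong₂ _+_ (g≗h zero) (sumFin-cong (g≗h ∘ suc))

sumFin-+ : ∀ {n} (g h : Fin n → ℕ) → sumFin (λ i → g i + h i) ≡ sumFin g + sumFin h
sumFin-+ {zero}  g h = refl
sumFin-+ {suc n} g h = trans (cong (g zero + h zero +_) (sumFin-+ (g ∘ suc) (h ∘ suc)))
                             (interchange (g zero) (h zero) _ _)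

sumFin-*ˡ : ∀ {n} k (g : Fin n → ℕ) → sumFin (λ i → k * g i) ≡ k * sumFin g
sumFin-*ˡ {zero}  k g = sym (*-zeroʳ k)
sumFin-*ˡ {suc n} k g = trans (cong (k * g zero +_) (sumFin-*ˡ k (g ∘ suc)))
                              (sym (*-distribˡ-+ k (g zero) _))

sumFin-*ʳ : ∀ {n} k (g : Fin n → ℕ) → sumFin (λ i → g i * k) ≡ sumFin g * k
sumFin-*ʳ k g = trans (sumFin-cong (λ i → *-comm (g i) k)) (trans (sumFin-*ˡ k g) (*-comm k _))

sumFin-const : ∀ {n} k → sumFin {n} (λ _ → k) ≡ n * k
sumFin-const {zero}  k = refl
sumFin-const {suc n} k = cong (k +_) (sumFin-const {n} k)

sumFin-zero : ∀ {n} {g : Fin n → ℕ} → (∀ i → g i ≡ 0) → sumFin g ≡ 0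
sumFin-zero {n} g≗0 = trans (sumFin-cong g≗0) (trans (sumFin-const {n} 0) (*-zeroʳ n))

δ : ∀ {n} → Fin n → Fin n → ℕ
δ u v = [ ⌊ u ≟ v ⌋ ]

δ-sym : ∀ {n} (u v : Fin n) → δ u v ≡ δ v u
δ-sym u v = cong [_] (≟-sym u v)

sumFin-δ : ∀ {n} (x : Fin n) (h : Fin n → ℕ) → sumFin (λ v → δ v x * h v) ≡ h x
sumFin-δ {suc n} zero    h =
  trans (cong₂ _+_ (*-identityˡ (h zero)) (sumFin-zero {n} (λ _ → refl))) (+-identityʳ (h zero))
sumFin-δ {suc n} (suc x) h = trans (sumFin-cong step) (sumFin-δ x (h ∘ suc))
  where
  step : ∀ v → δ (suc v) (suc x) * h (suc v) ≡ δ v x * h (suc v)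
  step v = cong (λ e → [ e ] * h (suc v)) (⌊⌋-map′ _ _ (v ≟ x))

sumFin² : ∀ {n} → (Fin n → Fin n → ℕ) → ℕ
sumFin² g = sumFin (λ u → sumFin (g u))

sumFin²-cong : ∀ {n} {g h : Fin n → Fin n → ℕ} → (∀ u v → g u v ≡ h u v) → sumFin² g ≡ sumFin² h
sumFin²-cong g≗h = sumFin-cong (λ u → sumFin-cong (g≗h u))

sumFin²-+ : ∀ {n} (g h : Fin n → Fin n → ℕ) →
  sumFin² (λ u v → g u v + h u v) ≡ sumFin² g + sumFin² h
sumFin²-+ g h = trans (sumFin-cong (λ u → sumFin-+ (g u) (h u)))
                      (sumFin-+ (λ u → sumFin (g u)) (λ u → sumFin (h u)))

sumFin²-separable : ∀ {n} (α β : Fin n → ℕ) → sumFin² (λ u v → α u * β v) ≡ sumFin α * sumFin β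
sumFin²-separable α β = trans (sumFin-cong (λ u → sumFin-*ˡ (α u) β)) (sumFin-*ʳ (sumFin β) α)

sumFin²-cross : ∀ {n} (p q : Fin n → ℕ) →
  sumFin² (λ u v → p u * q v + q u * p v) ≡ sumFin p * sumFin q + sumFin q * sumFin p
sumFin²-cross p q = trans (sumFin²-+ (λ u v → p u * q v) (λ u v → q u * p v))
                          (cong₂ _+_ (sumFin²-separable p q) (sumFin²-separable q p))

pairSum-cong : ∀ {n} {g h : Fin n → Fin n → ℕ} → (∀ u v → g u v ≡ h u v) → pairSum g ≡ pairSum h
pairSum-cong g≗h = sumFin-cong (λ u → sumFin-cong (λ v →
  cong (λ t → if ⌊ u <? v ⌋ then t else 0) (g≗h u v)))

pairSum-suc : ∀ {n} (g : Fin (suc n) → Fin (suc n) → ℕ) →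
  pairSum g ≡ sumFin (λ v → g zero (suc v)) + pairSum (λ u v → g (suc u) (suc v))
pairSum-suc g = cong (sumFin (λ v → g zero (suc v)) +_) (sumFin-cong λ u → sumFin-cong λ v →
  cong (λ t → if t then g (suc u) (suc v) else 0)
       (trans (⌊⌋-map′ _ _ _) (sym (⌊⌋-map′ _ _ _))))

sumFin²-split : ∀ {n} (g : Fin n → Fin n → ℕ) →
  sumFin² g ≡ pairSum g + pairSum (λ u v → g v u) + sumFin (λ u → g u u)
sumFin²-split {zero}  g = refl
sumFin²-split {suc n} g = begin
  g₀₀ + R + (sumFin (λ u → g (suc u) zero + sumFin (g' u)))
    ≡⟨ cong (g₀₀ + R +_) (sumFin-+ (λ u → g (suc u) zero) (λ u → sumFin (g' u))) ⟩
  g₀₀ + R + (C + sumFin² g')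
    ≡⟨ cong (λ t → g₀₀ + R + (C + t)) (sumFin²-split g') ⟩
  g₀₀ + R + (C + (pairSum g' + pairSum (λ u v → g' v u) + sumFin (λ u → g' u u)))
    ≡⟨ shuffle g₀₀ R C (pairSum g') _ _ ⟩
  R + pairSum g' + (C + pairSum (λ u v → g' v u)) + (g₀₀ + sumFin (λ u → g' u u))
    ≡⟨ sym (cong₂ (λ p q → p + q + (g₀₀ + sumFin (λ u → g' u u)))
                  (pairSum-suc g) (pairSum-suc (λ u v → g v u))) ⟩
  pairSum g + pairSum (λ u v → g v u) + sumFin (λ u → g u u) ∎
  where
  open ≡-Reasoning
  g' : Fin n → Fin n → ℕ
  g' u v = g (suc u) (suc v)
  g₀₀ R C : ℕ
  g₀₀ = g zero zero
  R = sumFin (λ v → g zero (suc v))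
  C = sumFin (λ u → g (suc u) zero)
  shuffle : ∀ d r c p p' e → d + r + (c + (p + p' + e)) ≡ r + p + (c + p') + (d + e)
  shuffle = solve-∀

pairSum-double : ∀ {n} (g : Fin n → Fin n → ℕ) →
  (∀ u v → g u v ≡ g v u) → (∀ u → g u u ≡ 0) → 2 * pairSum g ≡ sumFin² g
pairSum-double g g-sym g-diag = sym (begin
  sumFin² g                                                ≡⟨ sumFin²-split g ⟩
  pairSum g + pairSum (λ u v → g v u) + sumFin (λ u → g u u) ≡⟨ cong₂ (λ p q → pairSum g + p + q)
                                                                  (pairSum-cong (λ u v → g-sym v u))
                                                                  (sumFin-zero g-diag) ⟩
  pairSum g + pairSum g + 0                                ≡⟨ twice (pairSum g) ⟩
  2 * pairSum g                                            ∎)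
  where
  open ≡-Reasoning
  twice : ∀ x → x + x + 0 ≡ 2 * x
  twice = solve-∀

[]-∧ : ∀ p q → [ p ∧ q ] ≡ [ p ] * [ q ]
[]-∧ true  q = sym (+-identityʳ [ q ])
[]-∧ false q = refl

[]-partition : ∀ x y z → (T x → T y → ⊥) → (T x → T z → ⊥) → (T y → T z → ⊥) →
  [ not x ∧ not (y ∨ z) ] + [ x ] + [ y ] + [ z ] ≡ 1
[]-partition true  true  _     x∩y _   _   = ⊥-elim (x∩y _ _)
[]-partition true  false true  _   x∩z _   = ⊥-elim (x∩z _ _)
[]-partition true  false false _   _   _   = refl
[]-partition false true  true  _   _   y∩z = ⊥-elim (y∩z _ _)
[]-partition false true  false _   _   _   = refl
[]-partition false false true  _   _   _   = refl
[]-partition false false false _   _   _   = refl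

module KnMinusEdgeSums (m : ℕ) (a b : Fin (suc m)) (a≢b : a ≢ b) where

  G : Graph (suc m)
  G = KnMinusEdge (suc m) a b

  isPair-sound : ∀ u v → T (isPair a b u v) → u ≡ a × v ≡ b
  isPair-sound u v u≡a∧v≡b with Equivalence.to (T-∧ {⌊ u ≟ a ⌋}) u≡a∧v≡b
  ... | u≡a , v≡b = toWitness u≡a , toWitness v≡b

  adj-partition : ∀ u v → [ adj G u v ] + δ u v + δ u a * δ v b + δ v a * δ u b ≡ 1
  adj-partition u v = trans
    (sym (cong₂ (λ p q → [ adj G u v ] + δ u v + p + q)
                ([]-∧ ⌊ u ≟ a ⌋ ⌊ v ≟ b ⌋) ([]-∧ ⌊ v ≟ a ⌋ ⌊ u ≟ b ⌋)))
    ([]-partition ⌊ u ≟ v ⌋ (isPair a b u v) (isPair a b v u) diag∩ab diag∩ba ab∩ba)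
    where
    diag∩ab : T ⌊ u ≟ v ⌋ → T (isPair a b u v) → ⊥
    diag∩ab u≡v uv with isPair-sound u v uv
    ... | u≡a , v≡b = a≢b (trans (sym u≡a) (trans (toWitness u≡v) v≡b))
    diag∩ba : T ⌊ u ≟ v ⌋ → T (isPair a b v u) → ⊥
    diag∩ba u≡v vu with isPair-sound v u vu
    ... | v≡a , u≡b = a≢b (trans (sym v≡a) (trans (sym (toWitness u≡v)) u≡b))
    ab∩ba : T (isPair a b u v) → T (isPair a b v u) → ⊥
    ab∩ba uv vu with isPair-sound u v uv | isPair-sound v u vu
    ... | _ , v≡b | v≡a , _ = a≢b (trans (sym v≡a) v≡b)

  sumFin²-adj : ∀ (h : Fin (suc m) → Fin (suc m) → ℕ) →
    sumFin² (λ u v → [ adj G u v ] * h u v) + h a b + h b a + sumFin (λ u → h u u) ≡ sumFin² h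
  sumFin²-adj h = begin
    sumFin² A + h a b + h b a + sumFin (λ u → h u u)
      ≡⟨ sym (cong₂ _+_ (cong₂ _+_ (cong (sumFin² A +_) sumFin²-C) sumFin²-D) sumFin²-B) ⟩
    sumFin² A + sumFin² C + sumFin² D + sumFin² B
      ≡⟨ sym (trans (sumFin²-+ (λ u v → A u v + C u v + D u v) B)
                    (cong (_+ sumFin² B) (trans (sumFin²-+ (λ u v → A u v + C u v) D)
                                                (cong (_+ sumFin² D) (sumFin²-+ A C))))) ⟩
    sumFin² (λ u v → A u v + C u v + D u v + B u v)
      ≡⟨ sumFin²-cong split ⟩
    sumFin² h ∎
    where
    open ≡-Reasoning
    A B C D : Fin (suc m) → Fin (suc m) → ℕ
    A u v = [ adj G u v ] * h u v
    B u v = δ u v * h u v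
    C u v = δ u a * (δ v b * h u v)
    D u v = δ u b * (δ v a * h u v)
    regroup : ∀ p q r s t w x → p * x + r * (s * x) + w * (t * x) + q * x ≡ (p + q + r * s + t * w) * x
    regroup = solve-∀
    split : ∀ u v → A u v + C u v + D u v + B u v ≡ h u v
    split u v = trans (regroup [ adj G u v ] (δ u v) (δ u a) (δ v b) (δ v a) (δ u b) (h u v))
                      (trans (cong (_* h u v) (adj-partition u v)) (*-identityˡ (h u v)))
    sumFin²-B : sumFin² B ≡ sumFin (λ u → h u u)
    sumFin²-B = sumFin-cong λ u →
      trans (sumFin-cong (λ v → cong (_* h u v) (δ-sym u v))) (sumFin-δ u (h u))
    sumFin²-C : sumFin² C ≡ h a b
    sumFin²-C = trans (sumFin-cong λ u → trans (sumFin-*ˡ (δ u a) (λ v → δ v b * h u v))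
                                               (cong (δ u a *_) (sumFin-δ b (h u))))
                      (sumFin-δ a (λ u → h u b))
    sumFin²-D : sumFin² D ≡ h b a
    sumFin²-D = trans (sumFin-cong λ u → trans (sumFin-*ˡ (δ u b) (λ v → δ v a * h u v))
                                               (cong (δ u b *_) (sumFin-δ a (h u))))
                      (sumFin-δ b (λ u → h u a))

  sumFin²-adj-sym : ∀ (h : Fin (suc m) → Fin (suc m) → ℕ) →
    (∀ u v → h u v ≡ h v u) → (∀ u → h u u ≡ 0) →
    sumFin² (λ u v → [ adj G u v ] * h u v) + 2 * h a b ≡ sumFin² h
  sumFin²-adj-sym h h-sym h-self = begin
    H + 2 * h a b                               ≡⟨ expand H (h a b) ⟩
    H + h a b + h a b + 0                       ≡⟨ cong₂ (λ p q → H + h a b + p + q)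
                                                         (h-sym a b) (sym (sumFin-zero h-self)) ⟩
    H + h a b + h b a + sumFin (λ u → h u u)    ≡⟨ sumFin²-adj h ⟩
    sumFin² h                                   ∎
    where
    open ≡-Reasoning
    H : ℕ
    H = sumFin² (λ u v → [ adj G u v ] * h u v)
    expand : ∀ x y → x + 2 * y ≡ x + y + y + 0
    expand = solve-∀

  degree-weighted : ∀ (w : Fin (suc m) → ℕ) →
    sumFin (λ u → degree G u * w u) + (w a + w b) ≡ m * sumFin w
  degree-weighted w = +-cancelʳ-≡ (sumFin w) _ _ (begin
    sumFin (λ u → degree G u * w u) + (w a + w b) + sumFin w
      ≡⟨ cong (_+ sumFin w) (sym (+-assoc (sumFin (λ u → degree G u * w u)) (w a) (w b))) ⟩
    sumFin (λ u → degree G u * w u) + w a + w b + sumFin w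
      ≡⟨ cong (λ t → t + w a + w b + sumFin w)
              (sumFin-cong λ u → sym (sumFin-*ʳ (w u) (λ v → [ adj G u v ]))) ⟩
    sumFin² (λ u v → [ adj G u v ] * w u) + w a + w b + sumFin w
      ≡⟨ sumFin²-adj (λ u _ → w u) ⟩
    sumFin² (λ u _ → w u)
      ≡⟨ trans (sumFin-cong (λ u → sumFin-const {suc m} (w u))) (sumFin-*ˡ (suc m) w) ⟩
    sumFin w + m * sumFin w
      ≡⟨ +-comm (sumFin w) _ ⟩
    m * sumFin w + sumFin w ∎)
    where open ≡-Reasoning

  vol+2 : vol G + 2 ≡ m * suc m
  vol+2 = begin
    vol G + 2
      ≡⟨ cong (_+ 2) (sumFin-cong λ u → sym (*-identityʳ (degree G u))) ⟩
    sumFin (λ u → degree G u * 1) + (1 + 1)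
      ≡⟨ degree-weighted (λ _ → 1) ⟩
    m * sumFin {suc m} (λ _ → 1)
      ≡⟨ cong (m *_) (trans (sumFin-const {suc m} 1) (*-identityʳ (suc m))) ⟩
    m * suc m ∎
    where open ≡-Reasoning

side : ∀ {n} → (Fin n → Fin 2) → Fin 2 → Fin n → ℕ
side f c u = δ (f u) c

distK2²-sides : ∀ x y → distK2 x y * distK2 x y ≡ δ x 0F * δ y 1F + δ x 1F * δ y 0F
distK2²-sides 0F 0F = refl
distK2²-sides 0F 1F = refl
distK2²-sides 1F 0F = refl
distK2²-sides 1F 1F = refl

distK2-sym : ∀ x y → distK2 x y ≡ distK2 y x
distK2-sym x y = cong (λ e → if e then 0 else 1) (≟-sym x y)

distK2-self : ∀ x → distK2 x x ≡ 0
distK2-self x = cong (λ e → if e then 0 else 1) (≟-refl x)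

module Cut {n} (G : Graph n) (f : Fin n → Fin 2) where

  d² : Fin n → Fin n → ℕ
  d² u v = distK2 (f u) (f v) * distK2 (f u) (f v)

  d²-sym : ∀ u v → d² u v ≡ d² v u
  d²-sym u v = cong (λ t → t * t) (distK2-sym (f u) (f v))

  d²-self : ∀ u → d² u u ≡ 0
  d²-self u = cong (λ t → t * t) (distK2-self (f u))

  side-size side-vol : Fin 2 → ℕ
  side-size c = sumFin (side f c)
  side-vol c = sumFin (λ u → degree G u * side f c u)

  crossing : ℕ
  crossing = sumFin² (λ u v → [ adj G u v ] * d² u v)

  side-size-sum : side-size 0F + side-size 1F ≡ n
  side-size-sum = begin
    side-size 0F + side-size 1F                         ≡⟨ sym (sumFin-+ (side f 0F) (side f 1F)) ⟩
    sumFin (λ u → side f 0F u + side f 1F u)  ≡⟨ sumFin-cong (λ u → one-side (f u)) ⟩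
    sumFin {n} (λ _ → 1)                                ≡⟨ trans (sumFin-const {n} 1) (*-identityʳ n) ⟩
    n                                                   ∎
    where
    open ≡-Reasoning
    one-side : ∀ x → δ x 0F + δ x 1F ≡ 1
    one-side 0F = refl
    one-side 1F = refl

  sumFin²-d² : sumFin² d² ≡ side-size 0F * side-size 1F + side-size 1F * side-size 0F
  sumFin²-d² = trans (sumFin²-cong (λ u v → distK2²-sides (f u) (f v)))
                     (sumFin²-cross (side f 0F) (side f 1F))

  denR-double : 2 * denR G f ≡ side-vol 0F * side-vol 1F + side-vol 1F * side-vol 0F
  denR-double = begin
    2 * denR G f    ≡⟨ pairSum-double weight weight-sym weight-self ⟩
    sumFin² weight  ≡⟨ sumFin²-cong weight-sides ⟩
    sumFin² (λ u v → weighted 0F u * weighted 1F v + weighted 1F u * weighted 0F v)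
                    ≡⟨ sumFin²-cross (weighted 0F) (weighted 1F) ⟩
    side-vol 0F * side-vol 1F + side-vol 1F * side-vol 0F ∎
    where
    open ≡-Reasoning
    weighted : Fin 2 → Fin n → ℕ
    weighted c u = degree G u * side f c u
    weight : Fin n → Fin n → ℕ
    weight u v = d² u v * degree G u * degree G v
    weight-sym : ∀ u v → weight u v ≡ weight v u
    weight-sym u v = trans (cong (λ t → t * degree G u * degree G v) (d²-sym u v))
                           (xy∙z≈xz∙y (d² v u) (degree G u) (degree G v))
    weight-self : ∀ u → weight u u ≡ 0
    weight-self u = cong (λ t → t * degree G u * degree G u) (d²-self u)
    expand : ∀ p q r s du dv → (p * q + r * s) * du * dv ≡ du * p * (dv * q) + du * r * (dv * s)
    expand = solve-∀
    weight-sides : ∀ u v → weight u v ≡ weighted 0F u * weighted 1F v + weighted 1F u * weighted 0F v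
    weight-sides u v = trans (cong (λ t → t * degree G u * degree G v) (distK2²-sides (f u) (f v)))
      (expand (side f 0F u) (side f 1F v) (side f 1F u) (side f 0F v) (degree G u) (degree G v))

  numR-double : 2 * numR G f ≡ vol G * crossing
  numR-double = trans (x∙yz≈y∙xz 2 (vol G) _) (cong (vol G *_) (pairSum-double _ cut-sym cut-self))
    where
    cut-sym : ∀ u v → [ adj G u v ] * d² u v ≡ [ adj G v u ] * d² v u
    cut-sym u v = cong₂ _*_ (cong [_] (Graph.sym G u v)) (d²-sym u v)
    cut-self : ∀ u → [ adj G u u ] * d² u u ≡ 0
    cut-self u = cong (λ e → [ e ] * d² u u) (irref G u)

missing-edge-uncut-bound : ∀ {m vol X D₀ D₁ S₀ S₁} → m * m ≤ vol → D₀ ≤ m * S₀ → D₁ ≤ m * S₁ →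
  X ≡ S₀ * S₁ + S₁ * S₀ → D₀ * D₁ + D₁ * D₀ ≤ vol * X
missing-edge-uncut-bound {m} {vol} {D₀ = D₀} {D₁} {S₀} {S₁} m²≤vol D₀≤ D₁≤ refl = begin
  D₀ * D₁ + D₁ * D₀                      ≤⟨ +-mono-≤ (*-mono-≤ D₀≤ D₁≤) (*-mono-≤ D₁≤ D₀≤) ⟩
  m * S₀ * (m * S₁) + m * S₁ * (m * S₀)  ≡⟨ regroup m S₀ S₁ ⟩
  m * m * (S₀ * S₁ + S₁ * S₀)            ≤⟨ *-monoˡ-≤ (S₀ * S₁ + S₁ * S₀) m²≤vol ⟩
  vol * (S₀ * S₁ + S₁ * S₀)              ∎
  where
  open ≤-Reasoning
  regroup : ∀ m s t → m * s * (m * t) + m * t * (m * s) ≡ m * m * (s * t + t * s)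
  regroup = solve-∀

-- The instance m = j + 2, S₀ = s + 1, S₁ = t + 1 of the cut case; the identity below is
-- vol X = 2 D₀ D₁ + 2 j S₀ S₁ + 2 with the constraint s + t = j + 1 added to both sides.
missing-edge-cut-bound-polynomial : ∀ j s t → s + t ≡ suc j →
  let D₀ = suc (suc j) * s + suc j ; D₁ = suc (suc j) * t + suc j in
  D₀ * D₁ + D₁ * D₀ ≤ (j * j + 5 * j + 4) * (2 * (s * t + s + t))
missing-edge-cut-bound-polynomial j s t s+t≡ = begin
  L          ≤⟨ m≤m+n L slack ⟩
  L + slack  ≡⟨ +-cancelʳ-≡ (2 * suc (suc j) * suc j) _ _ balanced ⟩
  V * Y      ∎
  where
  open ≤-Reasoning
  D₀ D₁ L V Y slack : ℕ
  D₀ = suc (suc j) * s + suc j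
  D₁ = suc (suc j) * t + suc j
  L = D₀ * D₁ + D₁ * D₀
  V = j * j + 5 * j + 4
  Y = 2 * (s * t + s + t)
  slack = 2 * j * suc s * suc t + 2
  identity : ∀ j s t →
    (j * j + 5 * j + 4) * (2 * (s * t + s + t)) + 2 * suc (suc j) * suc j ≡
      (suc (suc j) * s + suc j) * (suc (suc j) * t + suc j)
      + (suc (suc j) * t + suc j) * (suc (suc j) * s + suc j)
      + (2 * j * suc s * suc t + 2) + 2 * suc (suc j) * (s + t)
  identity = solve-∀
  balanced : L + slack + 2 * suc (suc j) * suc j ≡ V * Y + 2 * suc (suc j) * suc j
  balanced = trans (cong (λ e → L + slack + 2 * suc (suc j) * e) (sym s+t≡)) (sym (identity j s t))

missing-edge-cut-bound : ∀ {m vol X D₀ D₁ S₀ S₁} →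
  2 ≤ m → S₀ + S₁ ≡ suc m → vol + 2 ≡ m * suc m →
  D₀ + 1 ≡ m * S₀ → D₁ + 1 ≡ m * S₁ → X + 2 ≡ S₀ * S₁ + S₁ * S₀ →
  D₀ * D₁ + D₁ * D₀ ≤ vol * X
missing-edge-cut-bound {m} {D₀ = D₀} {S₀ = zero} _ _ _ D₀+1≡ _ _ =
  ⊥-elim (m+1+n≢0 D₀ (trans D₀+1≡ (*-zeroʳ m)))
missing-edge-cut-bound {m} {D₁ = D₁} {S₀ = suc _} {zero} _ _ _ _ D₁+1≡ _ =
  ⊥-elim (m+1+n≢0 D₁ (trans D₁+1≡ (*-zeroʳ m)))
missing-edge-cut-bound {suc (suc j)} {vol} {X} {D₀} {D₁} {suc s} {suc t}
                       (s≤s (s≤s _)) S₀+S₁≡ vol+2≡ D₀+1≡ D₁+1≡ X+2≡ =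
  substitute (+-cancelʳ-≡ 1 D₀ _ (trans D₀+1≡ (linear j s)))
             (+-cancelʳ-≡ 1 D₁ _ (trans D₁+1≡ (linear j t)))
             (+-cancelʳ-≡ 2 vol _ (trans vol+2≡ (volume j)))
             (+-cancelʳ-≡ 2 X _ (trans X+2≡ (crossings s t)))
  where
  s+t≡ : s + t ≡ suc j
  s+t≡ = suc-injective (trans (sym (+-suc s t)) (suc-injective S₀+S₁≡))
  linear : ∀ j s → suc (suc j) * suc s ≡ suc (suc j) * s + suc j + 1
  linear = solve-∀
  volume : ∀ j → suc (suc j) * suc (suc (suc j)) ≡ j * j + 5 * j + 4 + 2
  volume = solve-∀
  crossings : ∀ s t → suc s * suc t + suc t * suc s ≡ 2 * (s * t + s + t) + 2
  crossings = solve-∀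
  substitute : ∀ {D₀ D₁ vol X} →
    D₀ ≡ suc (suc j) * s + suc j → D₁ ≡ suc (suc j) * t + suc j →
    vol ≡ j * j + 5 * j + 4 → X ≡ 2 * (s * t + s + t) → D₀ * D₁ + D₁ * D₀ ≤ vol * X
  substitute refl refl refl refl = missing-edge-cut-bound-polynomial j s t s+t≡

m²≤vol : ∀ {m vol} → 2 ≤ m → vol + 2 ≡ m * suc m → m * m ≤ vol
m²≤vol {m} {vol} 2≤m vol+2≡ = +-cancelʳ-≤ 2 (m * m) vol (begin
  m * m + 2  ≤⟨ +-monoʳ-≤ (m * m) 2≤m ⟩
  m * m + m  ≡⟨ +-comm (m * m) m ⟩
  m + m * m  ≡⟨ sym (*-suc m m) ⟩
  m * suc m  ≡⟨ sym vol+2≡ ⟩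
  vol + 2    ∎)
  where open ≤-Reasoning

missing-edge-bound : ∀ {m vol X D₀ D₁ S₀ S₁} (x y : Fin 2) →
  2 ≤ m → S₀ + S₁ ≡ suc m → vol + 2 ≡ m * suc m →
  D₀ + (δ x 0F + δ y 0F) ≡ m * S₀ → D₁ + (δ x 1F + δ y 1F) ≡ m * S₁ →
  X + 2 * (distK2 x y * distK2 x y) ≡ S₀ * S₁ + S₁ * S₀ →
  D₀ * D₁ + D₁ * D₀ ≤ vol * X
missing-edge-bound {m} {D₀ = D₀} {D₁} {S₀} {S₁} 0F 0F 2≤m _ vol+2≡ D₀+2≡ D₁+0≡ X+0≡ =
  missing-edge-uncut-bound {m} {S₀ = S₀} {S₁} (m²≤vol 2≤m vol+2≡) (m+n≤o⇒m≤o D₀ (≤-reflexive D₀+2≡))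
    (m+n≤o⇒m≤o D₁ (≤-reflexive D₁+0≡)) (trans (sym (+-identityʳ _)) X+0≡)
missing-edge-bound {m} {D₀ = D₀} {D₁} {S₀} {S₁} 1F 1F 2≤m _ vol+2≡ D₀+0≡ D₁+2≡ X+0≡ =
  missing-edge-uncut-bound {m} {S₀ = S₀} {S₁} (m²≤vol 2≤m vol+2≡) (m+n≤o⇒m≤o D₀ (≤-reflexive D₀+0≡))
    (m+n≤o⇒m≤o D₁ (≤-reflexive D₁+2≡)) (trans (sym (+-identityʳ _)) X+0≡)
missing-edge-bound 0F 1F = missing-edge-cut-bound
missing-edge-bound 1F 0F = missing-edge-cut-bound

theorem6p10 : (n : ℕ) → 3 ≤ n → (a b : Fin n) → a ≢ b → λK2≥1 (KnMinusEdge n a b)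
theorem6p10 (suc m) (s≤s 2≤m) a b a≢b f _ =
  *-cancelˡ-≤ 2 (subst₂ _≤_ (sym denR-double) (sym numR-double)
    (missing-edge-bound {D₀ = side-vol 0F} {side-vol 1F} (f a) (f b) 2≤m side-size-sum vol+2
      (degree-weighted (side f 0F))
      (degree-weighted (side f 1F))
      (trans (sumFin²-adj-sym d² d²-sym d²-self) sumFin²-d²)))
  where
  open KnMinusEdgeSums m a b a≢b
  open Cut G f
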